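{- Let $q$ be a prime power and let $(u_n)_{n\ge 0}$ be a $q$-automatic sequence over $\mathbb{F}_q$ which is not ultimately periodic, with generating function $G(t)=\sum_{n\ge 0}u_nt^n\in\mathbb{F}_q[[t]]$. Let $h(s,t)=h_0(t)+h_1(t)s+\dots+h_d(t)s^d\in\mathbb{F}_q[s,t]$ be a non-zero polynomial (with $h_i\in\mathbb{F}_q[t]$) such that $h(G(t),t)=0$ and such that $h(s,t)$, viewed as a polynomial in $s$, has no zero $s\in\mathbb{F}_q(t)$. Put $$M=\max_{0\le i\le d}\{\deg h_i-i\}.$$ Then for every $N\ge 1$, $$\frac{N-M}{d}\le L(u_n,N)\le \frac{(d-1)N+M+1}{d}.$$
   Context: A sequence $(u_n)$ over an alphabet is $k$-automatic if it is the output sequence of a finite automaton whose input is the $k$-ary digital expansion of $n$ (equivalently, for $k=q$ a prime power and alphabet $\mathbb{F}_q$, its generating function is algebraic over $\mathbb{F}_q(t)$). A sequence is ultimately periodic if it is periodic from some index on. The $N$th linear complexity $L(u_n,N)$ is the least $L\ge 0$ such that there exist $c_0,\dots,c_{L-1}\in\mathbb{F}_q$ with $u_{n+L}=c_{L-1}u_{n+L-1}+\dots+c_0u_n$ for all $0\le n\le N-L-1$; by convention $L(u_n,N)=0$ if $u_0=\dots=u_{N-1}=0$, and $L(u_n,N)=N$ if $u_0=\dots=u_{N-2}=0\ne u_{N-1}$. -}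

module Defs where

open import Level using (0ℓ)
open import Data.Nat as ℕ using (ℕ; zero; suc; _<_; _≤_)
open import Data.Nat.DivMod using (_mod_; _/_)
open import Data.Nat.Primality using (Prime)
open import Data.Integer as ℤ using (ℤ; +_)
open import Data.Fin using (Fin; toℕ)
import Data.Fin as Fin
open import Data.List using (List; []; _∷_; foldr)
open import Data.List.Relation.Unary.Any using (Any)
open import Data.Vec using (Vec; lookup)
open import Data.Maybe using (Maybe; just; nothing)
import Data.Maybe as Maybe
open import Data.Product using (Σ; _×_; _,_)
open import Relation.Nullary using (¬_; Dec; yes; no)
open import Relation.Binary.PropositionalEquality using (_≡_; _≢_)
open import Algebra.Structures using (IsCommutativeRing)
open import Function.Bundles using (_↔_)

IsPrimePower : ℕ → Set
IsPrimePower q = Σ ℕ λ p → Σ ℕ λ k → Prime p × q ≡ p ℕ.^ suc k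

record FiniteField (q : ℕ) : Set₁ where
  infixl 7 _*_
  infixl 6 _+_
  field
    Carrier : Set
    _≟_     : (x y : Carrier) → Dec (x ≡ y)
    _+_ _*_ : Carrier → Carrier → Carrier
    -_      : Carrier → Carrier
    0# 1#   : Carrier
    isCommutativeRing : IsCommutativeRing _≡_ _+_ _*_ -_ 0# 1#
    0≢1     : 0# ≢ 1#
    inverse : ∀ x → x ≢ 0# → Σ Carrier λ y → x * y ≡ 1#
    enumeration : Carrier ↔ Fin q

-- Base-q digits of n, least significant digit first (empty for n = 0).
-- Only meaningful for q ≥ 2 (bases 0 and 1 give the empty list).

digitsLSB : (q : ℕ) → ℕ → List (Fin q)
digitsLSB zero _ = []
digitsLSB (suc zero) _ = []
digitsLSB (suc (suc k)) n = go n n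
  where
  go : ℕ → ℕ → List (Fin (suc (suc k)))
  go zero _ = []
  go (suc f) zero = []
  go (suc f) (suc m) = (suc m mod suc (suc k)) ∷ go f (suc m / suc (suc k))

-- A deterministic finite automaton with output (DFAO) with m states,
-- reading the q-ary expansion of n starting with the most significant
-- digit (foldr over the LSB-first list processes the most significant
-- digit first).

runDFAO : ∀ {q m} → Fin m → (Fin m → Fin q → Fin m) → ℕ → Fin m
runDFAO {q} s₀ δ n = foldr (λ dgt s → δ s dgt) s₀ (digitsLSB q n)

IsAutomatic : (q : ℕ) {A : Set} → (ℕ → A) → Set
IsAutomatic q {A} u =
  Σ ℕ λ m → Σ (Fin m) λ s₀ → Σ (Fin m → Fin q → Fin m) λ δ →
  Σ (Fin m → A) λ τ → ∀ n → u n ≡ τ (runDFAO s₀ δ n)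

UltimatelyPeriodic : {A : Set} → (ℕ → A) → Set
UltimatelyPeriodic u =
  Σ ℕ λ n₀ → Σ ℕ λ p → 0 < p × (∀ n → n₀ ≤ n → u (n ℕ.+ p) ≡ u n)

module FieldNotions {q : ℕ} (F : FiniteField q) where
  open FiniteField F

  sumBelow : (ℕ → Carrier) → ℕ → Carrier
  sumBelow f zero = 0#
  sumBelow f (suc n) = sumBelow f n + f n

  sumFin : ∀ {n} → (Fin n → Carrier) → Carrier
  sumFin {zero} f = 0#
  sumFin {suc n} f = f Fin.zero + sumFin (λ i → f (Fin.suc i))

  Series : Set
  Series = ℕ → Carrier

  IsZeroSeries : Series → Set
  IsZeroSeries f = ∀ n → f n ≡ 0#

  oneS : Series
  oneS zero = 1#
  oneS (suc _) = 0#

  _⊕_ : Series → Series → Series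
  (f ⊕ g) n = f n + g n

  _⊛_ : Series → Series → Series
  (f ⊛ g) n = sumBelow (λ k → f k * g (n ℕ.∸ k)) (suc n)

  _^S_ : Series → ℕ → Series
  f ^S zero = oneS
  f ^S suc i = f ⊛ (f ^S i)

  sumFinS : ∀ {n} → (Fin n → Series) → Series
  sumFinS f n = sumFin (λ i → f i n)

  -- polynomials in t: coefficient lists (constant term first)
  Poly : Set
  Poly = List Carrier

  toSeries : Poly → Series
  toSeries [] _ = 0#
  toSeries (c ∷ cs) zero = c
  toSeries (c ∷ cs) (suc n) = toSeries cs n

  NonZeroPoly : Poly → Set
  NonZeroPoly p = Any (λ c → c ≢ 0#) p

  deg : Poly → Maybe ℕ
  deg [] = nothing
  deg (c ∷ cs) with deg cs
  ... | just k = just (suc k)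
  ... | nothing with c ≟ 0#
  ...   | yes _ = nothing
  ...   | no _ = just 0

  -- A polynomial h(s,t) = Σ_{i=0}^{d} h_i(t) s^i is a vector of its
  -- coefficients h_0 … h_d in F_q[t].
  SPoly : ℕ → Set
  SPoly d = Vec Poly (suc d)

  NonZeroSPoly : ∀ {d} → SPoly d → Set
  NonZeroSPoly h = Σ (Fin _) λ i → NonZeroPoly (lookup h i)

  evalAt : ∀ {d} → SPoly d → Series → Series
  evalAt h G = sumFinS (λ i → toSeries (lookup h i) ⊛ (G ^S toℕ i))

  -- b(t)^d · h(a(t)/b(t), t) = Σ_i h_i a^i b^(d-i)
  homogenised : ∀ {d} → SPoly d → Poly → Poly → Series
  homogenised {d} h a b =
    sumFinS (λ i → toSeries (lookup h i) ⊛
                   ((toSeries a ^S toℕ i) ⊛ (toSeries b ^S (d ℕ.∸ toℕ i))))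

  -- h has no zero s = a/b ∈ F_q(t) (b ≠ 0)
  NoRationalRoot : ∀ {d} → SPoly d → Set
  NoRationalRoot h =
    (a b : Poly) → NonZeroPoly b → ¬ IsZeroSeries (homogenised h a b)

  -- M = max_{i : h_i ≠ 0} (deg h_i − i); nothing if h = 0
  maxM : Maybe ℤ → Maybe ℤ → Maybe ℤ
  maxM nothing y = y
  maxM (just x) nothing = just x
  maxM (just x) (just y) = just (x ℤ.⊔ y)

  maxFin : ∀ {n} → (Fin n → Maybe ℤ) → Maybe ℤ
  maxFin {zero} f = nothing
  maxFin {suc n} f = maxM (f Fin.zero) (maxFin (λ i → f (Fin.suc i)))

  Mof : ∀ {d} → SPoly d → Maybe ℤ
  Mof h = maxFin (λ i → Maybe.map (λ k → + k ℤ.- + toℕ i) (deg (lookup h i)))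

  HasRecurrence : (ℕ → Carrier) → (N L : ℕ) → Set
  HasRecurrence u N L =
    Σ (Fin L → Carrier) λ c →
      ∀ n → n ℕ.+ L < N →
        u (n ℕ.+ L) ≡ sumFin (λ j → c j * u (n ℕ.+ toℕ j))

  IsLinearComplexity : (ℕ → Carrier) → (N L : ℕ) → Set
  IsLinearComplexity u N L =
    HasRecurrence u N L × (∀ L′ → L′ < L → ¬ HasRecurrence u N L′)

module Submission where

-- A linear recurrence of length ℓ valid for the first N terms is encoded by its monic
-- characteristic vector a (a_ℓ = 1) with Σ_{j≤ℓ} a_j u_{n+j} = 0 whenever n + ℓ < N.
--
-- Let g(t) = Σ_k a_{ℓ−k} t^k be the reversed characteristic polynomial
-- (deg g ≤ ℓ, g(0) = 1) and f the truncation of g·G below t^ℓ.  The recurrence says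
-- f ≡ g·G (mod t^N), hence  g^d·h(f/g) = Σ_i h_i f^i g^(d−i) ≡ g^d·h(G) = 0 (mod t^N).
-- Its degree is at most M + dℓ, so if N > M + dℓ it vanishes and f/g is a rational
-- zero of h, which is excluded.  Hence N − M ≤ dℓ for every such recurrence.
--
-- Massey's construction (the Berlekamp–Massey algorithm) yields, for each
-- N, a recurrence valid for N whose length either stays the same from N to N+1 or jumps
-- to some k with k + ℓ ≤ N + 1, where ℓ is the length of a recurrence valid for N.  We
-- state this for an arbitrary length invariant P; with P N ℓ := dℓ ≤ (d−1)N + M + 1 the
-- jump case is exactly where the lower bound is used.  Minimality of L(u,N) finishes.

open import Defs
open import Level using (0ℓ)
open import Data.Nat as ℕ using (ℕ; zero; suc; _<_; _≤_; z≤n; s≤s; _∸_)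
import Data.Nat.Properties as ℕP
open import Data.Fin using (Fin; toℕ)
import Data.Fin as Fin
import Data.Fin.Properties as FinP
open import Data.Integer as ℤ using (ℤ; 0ℤ) renaming (_≤_ to _≤ℤ_)
import Data.Integer.Properties as ℤP
open import Data.Integer.Tactic.RingSolver using (solve-∀)
open import Data.List using ([]; _∷_)
open import Data.List.Relation.Unary.Any using (here)
open import Data.Maybe using (Maybe; just; nothing)
import Data.Maybe as Maybe
open import Data.Vec using (lookup)
open import Data.Product using (Σ; _×_; _,_; proj₁; proj₂)
open import Data.Sum using (_⊎_; inj₁; inj₂; map₂)
open import Data.Empty using (⊥; ⊥-elim)
open import Relation.Nullary using (¬_; Dec; yes; no)
open import Relation.Binary.PropositionalEquality
open import Algebra.Structures using (IsCommutativeRing)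
open import Algebra.Bundles using (CommutativeRing)
open import Relation.Binary.Bundles using (Setoid)
import Relation.Binary.Reasoning.Setoid as SetoidReasoning

-- a ≤ b, witnessed by writing b − a as a sum of two non-negative integers; every
-- integer inequality below is reduced to a ring identity (solve-∀) in this way.
≤-byDifference : ∀ {a b} x y → 0ℤ ≤ℤ x → 0ℤ ≤ℤ y → b ℤ.- a ≡ x ℤ.+ y → a ≤ℤ b
≤-byDifference x y 0≤x 0≤y eq = ℤP.0≤i-j⇒j≤i (subst (0ℤ ≤ℤ_) (sym eq) (ℤP.+-mono-≤ 0≤x 0≤y))

module UpperBoundArithmetic (d : ℕ) (M : ℤ) where
  open import Data.Integer using (+_; _-_)

  UpperBound : ℕ → ℕ → Set
  UpperBound N ℓ = + d ℤ.* + ℓ ≤ℤ (+ d - + 1) ℤ.* + N ℤ.+ M ℤ.+ + 1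

  upperBound-zero : + 0 - M ≤ℤ + d ℤ.* + 0 → UpperBound 0 0
  upperBound-zero lower = ≤-byDifference _ _ (ℤP.i≤j⇒0≤j-i lower) (ℤ.+≤+ z≤n) (identity (+ d) M)
    where
    identity : ∀ D M → ((D - + 1) ℤ.* + 0 ℤ.+ M ℤ.+ + 1) - D ℤ.* + 0 ≡
                       (D ℤ.* + 0 - (+ 0 - M)) ℤ.+ + 1
    identity = solve-∀

  -- for d ≥ 1 the right-hand side grows with N, so a length may be kept
  upperBound-suc : 1 ≤ d → ∀ {N ℓ} → UpperBound N ℓ → UpperBound (suc N) ℓ
  upperBound-suc d≥1 {N} {ℓ} bound =
    ≤-byDifference _ _ (ℤP.i≤j⇒0≤j-i bound) (ℤP.i≤j⇒0≤j-i (ℤ.+≤+ d≥1)) (identity (+ d) (+ ℓ) (+ N) M)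
    where
    identity : ∀ D L N M → ((D - + 1) ℤ.* (+ 1 ℤ.+ N) ℤ.+ M ℤ.+ + 1) - D ℤ.* L ≡
                           (((D - + 1) ℤ.* N ℤ.+ M ℤ.+ + 1) - D ℤ.* L) ℤ.+ (D - + 1)
    identity = solve-∀

  upperBound-jump : ∀ {N ℓ k} → + N - M ≤ℤ + d ℤ.* + ℓ → k ℕ.+ ℓ ≤ suc N → UpperBound (suc N) k
  upperBound-jump {N} {ℓ} {k} lower k+ℓ≤ =
    ≤-byDifference _ _ (subst (_≤ℤ + d ℤ.* room) (ℤP.*-zeroʳ (+ d)) (ℤP.*-monoˡ-≤-nonNeg (+ d) 0≤room))
                       (ℤP.i≤j⇒0≤j-i lower) (identity (+ d) (+ N) (+ k) (+ ℓ) M)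
    where
    room : ℤ
    room = (+ 1 ℤ.+ + N) - (+ k ℤ.+ + ℓ)
    0≤room : 0ℤ ≤ℤ room
    0≤room = ℤP.i≤j⇒0≤j-i (ℤ.+≤+ k+ℓ≤)
    identity : ∀ D N K L M → ((D - + 1) ℤ.* (+ 1 ℤ.+ N) ℤ.+ M ℤ.+ + 1) - D ℤ.* K ≡
                             D ℤ.* ((+ 1 ℤ.+ N) - (K ℤ.+ L)) ℤ.+ (D ℤ.* L - (N - M))
    identity = solve-∀

  -- N − M ≤ 0 fails for N = |M| + 1; this rules out d = 0 given the lower bound
  overshoot : ¬ (+ suc ℤ.∣ M ∣ - M ≤ℤ 0ℤ)
  overshoot bad = ℤP.<-irrefl refl (ℤP.<-≤-trans 0<N-M bad)
    where
    i≤∣i∣ : ∀ i → i ≤ℤ + ℤ.∣ i ∣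
    i≤∣i∣ (+ n) = ℤP.≤-refl
    i≤∣i∣ ℤ.-[1+ n ] = ℤ.-≤+
    identity : ∀ A M → ((+ 1 ℤ.+ A) - M) - (+ 1 ℤ.+ 0ℤ) ≡ (A - M) ℤ.+ 0ℤ
    identity = solve-∀
    0<N-M : 0ℤ ℤ.< + suc ℤ.∣ M ∣ - M
    0<N-M = ℤP.suc[i]≤j⇒i<j (≤-byDifference _ 0ℤ (ℤP.i≤j⇒0≤j-i (i≤∣i∣ M)) ℤP.≤-refl
                                             (identity (+ ℤ.∣ M ∣) M))

module Proof {q : ℕ} (F : FiniteField q) where
  open FiniteField F
  open FieldNotions F
  open IsCommutativeRing isCommutativeRing
    using (+-assoc; +-comm; +-identityˡ; +-identityʳ; *-assoc; *-comm; *-identityˡ; *-identityʳ;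
           distribˡ; distribʳ; zeroˡ; zeroʳ; -‿inverseʳ)
  private
    ring : CommutativeRing 0ℓ 0ℓ
    ring = record { isCommutativeRing = isCommutativeRing }
  open import Algebra.Properties.Ring (CommutativeRing.ring ring)
    using (-‿distribˡ-*; -0#≈0#; -‿+-comm; +-inverseʳ-unique)

  module FiniteSums where
    open ≡-Reasoning

    sumBelow-cong : ∀ {f g} n → (∀ k → k < n → f k ≡ g k) → sumBelow f n ≡ sumBelow g n
    sumBelow-cong zero e = refl
    sumBelow-cong (suc n) e = cong₂ _+_ (sumBelow-cong n (λ k k<n → e k (ℕP.m<n⇒m<1+n k<n))) (e n (ℕP.n<1+n n))

    sumBelow-zero : ∀ {f} n → (∀ k → k < n → f k ≡ 0#) → sumBelow f n ≡ 0#
    sumBelow-zero n e = trans (sumBelow-cong n e) (sumBelow-const0 n)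
      where
      sumBelow-const0 : ∀ n → sumBelow (λ _ → 0#) n ≡ 0#
      sumBelow-const0 zero = refl
      sumBelow-const0 (suc n) = trans (cong (_+ 0#) (sumBelow-const0 n)) (+-identityˡ 0#)

    +-interchange : ∀ a b c d → (a + b) + (c + d) ≡ (a + c) + (b + d)
    +-interchange a b c d = begin
      (a + b) + (c + d) ≡⟨ +-assoc a b (c + d) ⟩
      a + (b + (c + d)) ≡⟨ cong (a +_) (sym (+-assoc b c d)) ⟩
      a + ((b + c) + d) ≡⟨ cong (λ x → a + (x + d)) (+-comm b c) ⟩
      a + ((c + b) + d) ≡⟨ cong (a +_) (+-assoc c b d) ⟩
      a + (c + (b + d)) ≡⟨ sym (+-assoc a c (b + d)) ⟩
      (a + c) + (b + d) ∎

    sumBelow-+ : ∀ f g n → sumBelow (λ k → f k + g k) n ≡ sumBelow f n + sumBelow g n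
    sumBelow-+ f g zero = sym (+-identityˡ 0#)
    sumBelow-+ f g (suc n) = trans (cong (_+ (f n + g n)) (sumBelow-+ f g n)) (+-interchange _ _ _ _)

    sumBelow-*ˡ : ∀ c f n → c * sumBelow f n ≡ sumBelow (λ k → c * f k) n
    sumBelow-*ˡ c f zero = zeroʳ c
    sumBelow-*ˡ c f (suc n) = trans (distribˡ c _ _) (cong (_+ (c * f n)) (sumBelow-*ˡ c f n))

    sumBelow-*ʳ : ∀ c f n → sumBelow f n * c ≡ sumBelow (λ k → f k * c) n
    sumBelow-*ʳ c f n = trans (*-comm _ c) (trans (sumBelow-*ˡ c f n) (sumBelow-cong n (λ k _ → *-comm c (f k))))

    sumBelow-neg : ∀ f n → sumBelow (λ k → - f k) n ≡ - sumBelow f n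
    sumBelow-neg f zero = sym -0#≈0#
    sumBelow-neg f (suc n) = trans (cong (_+ - f n) (sumBelow-neg f n)) (-‿+-comm _ _)

    sumBelow-head : ∀ f n → sumBelow f (suc n) ≡ f 0 + sumBelow (λ k → f (suc k)) n
    sumBelow-head f zero = trans (+-identityˡ _) (sym (+-identityʳ _))
    sumBelow-head f (suc n) = trans (cong (_+ f (suc n)) (sumBelow-head f n)) (+-assoc _ _ _)

    sumBelow-split : ∀ f m n → sumBelow f (m ℕ.+ n) ≡ sumBelow f m + sumBelow (λ k → f (m ℕ.+ k)) n
    sumBelow-split f m zero = trans (cong (sumBelow f) (ℕP.+-identityʳ m)) (sym (+-identityʳ _))
    sumBelow-split f m (suc n) = begin
      sumBelow f (m ℕ.+ suc n)                                      ≡⟨ cong (sumBelow f) (ℕP.+-suc m n) ⟩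
      sumBelow f (m ℕ.+ n) + f (m ℕ.+ n)                            ≡⟨ cong (_+ f (m ℕ.+ n)) (sumBelow-split f m n) ⟩
      (sumBelow f m + sumBelow (λ k → f (m ℕ.+ k)) n) + f (m ℕ.+ n) ≡⟨ +-assoc _ _ _ ⟩
      sumBelow f m + sumBelow (λ k → f (m ℕ.+ k)) (suc n)           ∎

    sumBelow-truncate : ∀ {f} m n → m ≤ n → (∀ k → m ≤ k → f k ≡ 0#) → sumBelow f n ≡ sumBelow f m
    sumBelow-truncate {f} m n m≤n vanish = begin
      sumBelow f n                                                 ≡⟨ cong (sumBelow f) (sym (ℕP.m+[n∸m]≡n m≤n)) ⟩
      sumBelow f (m ℕ.+ (n ∸ m))                                   ≡⟨ sumBelow-split f m (n ∸ m) ⟩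
      sumBelow f m + sumBelow (λ k → f (m ℕ.+ k)) (n ∸ m)           ≡⟨ cong (sumBelow f m +_)
                                                                        (sumBelow-zero (n ∸ m) (λ k _ → vanish _ (ℕP.m≤m+n m k))) ⟩
      sumBelow f m + 0#                                            ≡⟨ +-identityʳ _ ⟩
      sumBelow f m                                                 ∎

    sumBelow-reverse : ∀ f n → sumBelow f n ≡ sumBelow (λ k → f (n ∸ suc k)) n
    sumBelow-reverse f zero = refl
    sumBelow-reverse f (suc n) = begin
      sumBelow f n + f n                            ≡⟨ cong (_+ f n) (sumBelow-reverse f n) ⟩
      sumBelow (λ k → f (n ∸ suc k)) n + f n        ≡⟨ +-comm _ _ ⟩
      f n + sumBelow (λ k → f (n ∸ suc k)) n        ≡⟨ sym (sumBelow-head (λ k → f (suc n ∸ suc k)) n) ⟩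
      sumBelow (λ k → f (suc n ∸ suc k)) (suc n)    ∎

    -- Fubini over the triangle {(k, m) : k ≤ m ≤ n}, the key to associativity of ⊛
    sumBelow-triangle : ∀ (T : ℕ → ℕ → Carrier) n →
      sumBelow (λ m → sumBelow (λ k → T k m) (suc m)) (suc n) ≡
      sumBelow (λ k → sumBelow (λ j → T k (k ℕ.+ j)) (suc (n ∸ k))) (suc n)
    sumBelow-triangle T zero = refl
    sumBelow-triangle T (suc n) = begin
      Rows n + Column (suc n) (suc n)                           ≡⟨ cong (_+ Column (suc n) (suc n)) (sumBelow-triangle T n) ⟩
      sumBelow (Tail n) (suc n) + (Column (suc n) n + T (suc n) (suc n))
                                                                ≡⟨ sym (+-assoc _ _ _) ⟩
      (sumBelow (Tail n) (suc n) + Column (suc n) n) + T (suc n) (suc n)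
                                                                ≡⟨ cong₂ _+_ (sym (sumBelow-+ _ _ (suc n))) lastTail ⟩
      sumBelow (λ k → Tail n k + T k (suc n)) (suc n) + Tail (suc n) (suc n)
                                                                ≡⟨ cong (_+ Tail (suc n) (suc n)) (sumBelow-cong (suc n) growTail) ⟩
      sumBelow (Tail (suc n)) (suc (suc n))                     ∎
      where
      Rows : ℕ → Carrier
      Rows n = sumBelow (λ m → sumBelow (λ k → T k m) (suc m)) (suc n)
      Column : ℕ → ℕ → Carrier
      Column m r = sumBelow (λ k → T k m) (suc r)
      Tail : ℕ → ℕ → Carrier
      Tail n k = sumBelow (λ j → T k (k ℕ.+ j)) (suc (n ∸ k))
      growTail : ∀ k → k < suc n → Tail n k + T k (suc n) ≡ Tail (suc n) k
      growTail k k<sn = begin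
        Tail n k + T k (suc n)              ≡⟨ cong (λ z → Tail n k + T k z) (sym k+[sn∸k]) ⟩
        Tail n k + T k (k ℕ.+ suc (n ∸ k))  ≡⟨ cong (λ z → sumBelow (λ j → T k (k ℕ.+ j)) (suc z)) (sym (ℕP.+-∸-assoc 1 k≤n)) ⟩
        Tail (suc n) k                      ∎
        where
        k≤n : k ≤ n
        k≤n = ℕP.≤-pred k<sn
        k+[sn∸k] : k ℕ.+ suc (n ∸ k) ≡ suc n
        k+[sn∸k] = trans (ℕP.+-suc k (n ∸ k)) (cong suc (ℕP.m+[n∸m]≡n k≤n))
      lastTail : T (suc n) (suc n) ≡ Tail (suc n) (suc n)
      lastTail = begin
        T (suc n) (suc n)               ≡⟨ cong (T (suc n)) (sym (ℕP.+-identityʳ (suc n))) ⟩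
        T (suc n) (suc n ℕ.+ 0)         ≡⟨ sym (+-identityˡ _) ⟩
        0# + T (suc n) (suc n ℕ.+ 0)    ≡⟨ cong (λ z → sumBelow (λ j → T (suc n) (suc n ℕ.+ j)) (suc z)) (sym (ℕP.n∸n≡0 n)) ⟩
        Tail (suc n) (suc n)            ∎

    sumFin-cong : ∀ {n} {f g : Fin n → Carrier} → (∀ i → f i ≡ g i) → sumFin f ≡ sumFin g
    sumFin-cong {zero} e = refl
    sumFin-cong {suc n} e = cong₂ _+_ (e Fin.zero) (sumFin-cong (λ i → e (Fin.suc i)))

    sumFin-zero : ∀ {n} {f : Fin n → Carrier} → (∀ i → f i ≡ 0#) → sumFin f ≡ 0#
    sumFin-zero {zero} e = refl
    sumFin-zero {suc n} e = trans (cong₂ _+_ (e Fin.zero) (sumFin-zero (λ i → e (Fin.suc i)))) (+-identityˡ 0#)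

    sumFin-+ : ∀ {n} (f g : Fin n → Carrier) → sumFin (λ i → f i + g i) ≡ sumFin f + sumFin g
    sumFin-+ {zero} f g = sym (+-identityˡ 0#)
    sumFin-+ {suc n} f g =
      trans (cong (f Fin.zero + g Fin.zero +_) (sumFin-+ (λ i → f (Fin.suc i)) (λ i → g (Fin.suc i))))
            (+-interchange _ _ _ _)

    sumFin-*ˡ : ∀ {n} c (f : Fin n → Carrier) → c * sumFin f ≡ sumFin (λ i → c * f i)
    sumFin-*ˡ {zero} c f = zeroʳ c
    sumFin-*ˡ {suc n} c f = trans (distribˡ c _ _) (cong (c * f Fin.zero +_) (sumFin-*ˡ c (λ i → f (Fin.suc i))))

    sumFin-toℕ : ∀ n (f : ℕ → Carrier) → sumFin {n} (λ j → f (toℕ j)) ≡ sumBelow f n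
    sumFin-toℕ zero f = refl
    sumFin-toℕ (suc n) f = trans (cong (f 0 +_) (sumFin-toℕ n (λ k → f (suc k)))) (sym (sumBelow-head f n))

    sumBelow-sumFin : ∀ {m} (T : Fin m → ℕ → Carrier) n →
      sumBelow (λ k → sumFin (λ i → T i k)) n ≡ sumFin (λ i → sumBelow (T i) n)
    sumBelow-sumFin {m} T zero = sym (sumFin-zero {m} (λ i → refl))
    sumBelow-sumFin T (suc n) =
      trans (cong (_+ sumFin (λ i → T i n)) (sumBelow-sumFin T n)) (sym (sumFin-+ (λ i → sumBelow (T i) n) (λ i → T i n)))

  open FiniteSums

  -- (a record rather than a bare ∀, so that both series can be read off its type)
  infix 4 _≈_
  record _≈_ (f g : Series) : Set where
    constructor mk≈
    field at : ∀ n → f n ≡ g n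
  open _≈_

  ≈-refl : ∀ {f} → f ≈ f
  ≈-refl = mk≈ λ _ → refl

  ≈-sym : ∀ {f g} → f ≈ g → g ≈ f
  ≈-sym e = mk≈ λ n → sym (at e n)

  ≈-trans : ∀ {f g h} → f ≈ g → g ≈ h → f ≈ h
  ≈-trans e e' = mk≈ λ n → trans (at e n) (at e' n)

  seriesSetoid : Setoid 0ℓ 0ℓ
  seriesSetoid = record
    { Carrier = Series ; _≈_ = _≈_
    ; isEquivalence = record { refl = ≈-refl ; sym = ≈-sym ; trans = ≈-trans } }

  ⊛-cong : ∀ {f f' g g'} → f ≈ f' → g ≈ g' → (f ⊛ g) ≈ (f' ⊛ g')
  ⊛-cong e e' = mk≈ λ n → sumBelow-cong (suc n) (λ k _ → cong₂ _*_ (at e k) (at e' (n ∸ k)))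

  ⊛-congˡ : ∀ {f f'} g → f ≈ f' → (f ⊛ g) ≈ (f' ⊛ g)
  ⊛-congˡ g e = ⊛-cong e (≈-refl {g})

  ⊛-congʳ : ∀ f {g g'} → g ≈ g' → (f ⊛ g) ≈ (f ⊛ g')
  ⊛-congʳ f e = ⊛-cong (≈-refl {f}) e

  ⊛-comm : ∀ f g → (f ⊛ g) ≈ (g ⊛ f)
  ⊛-comm f g = mk≈ λ n → trans (sumBelow-reverse (λ k → f k * g (n ∸ k)) (suc n)) (sumBelow-cong (suc n) λ k k<sn →
     trans (*-comm _ _) (cong (λ z → g z * f (n ∸ k)) (ℕP.m∸[m∸n]≡n (ℕP.≤-pred k<sn))))

  ⊛-identityˡ : ∀ f → (oneS ⊛ f) ≈ f
  ⊛-identityˡ f = mk≈ λ n → begin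
    (oneS ⊛ f) n                                        ≡⟨ sumBelow-head (λ k → oneS k * f (n ∸ k)) n ⟩
    1# * f n + sumBelow (λ k → 0# * f (n ∸ suc k)) n    ≡⟨ cong₂ _+_ (*-identityˡ _) (sumBelow-zero n (λ k _ → zeroˡ _)) ⟩
    f n + 0#                                            ≡⟨ +-identityʳ _ ⟩
    f n                                                 ∎
    where open ≡-Reasoning

  ⊛-assoc : ∀ f g h → ((f ⊛ g) ⊛ h) ≈ (f ⊛ (g ⊛ h))
  ⊛-assoc f g h = mk≈ λ n → begin
    ((f ⊛ g) ⊛ h) n                                          ≡⟨ sumBelow-cong (suc n) (λ m _ →
                                                                  sumBelow-*ʳ (h (n ∸ m)) (λ k → f k * g (m ∸ k)) (suc m)) ⟩
    sumBelow (λ m → sumBelow (λ k → T n k m) (suc m)) (suc n)  ≡⟨ sumBelow-triangle (T n) n ⟩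
    sumBelow (λ k → sumBelow (λ j → T n k (k ℕ.+ j)) (suc (n ∸ k))) (suc n)
                                                             ≡⟨ sumBelow-cong (suc n) (λ k _ → inner n k) ⟩
    (f ⊛ (g ⊛ h)) n                                          ∎
    where
    open ≡-Reasoning
    T : ℕ → ℕ → ℕ → Carrier
    T n k m = f k * g (m ∸ k) * h (n ∸ m)
    inner : ∀ n k → sumBelow (λ j → T n k (k ℕ.+ j)) (suc (n ∸ k)) ≡ f k * (g ⊛ h) (n ∸ k)
    inner n k = begin
      sumBelow (λ j → T n k (k ℕ.+ j)) (suc (n ∸ k))          ≡⟨ sumBelow-cong (suc (n ∸ k)) (λ j _ → trans (*-assoc _ _ _)
                                                                   (cong₂ (λ a b → f k * (g a * h b)) (ℕP.m+n∸m≡n k j)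
                                                                          (sym (ℕP.∸-+-assoc n k j)))) ⟩
      sumBelow (λ j → f k * (g j * h (n ∸ k ∸ j))) (suc (n ∸ k)) ≡⟨ sym (sumBelow-*ˡ (f k) _ (suc (n ∸ k))) ⟩
      f k * (g ⊛ h) (n ∸ k)                                   ∎

  ⊛-sumFinS : ∀ {m} f (s : Fin m → Series) → (f ⊛ sumFinS s) ≈ sumFinS (λ i → f ⊛ s i)
  ⊛-sumFinS f s = mk≈ λ n →
    trans (sumBelow-cong (suc n) (λ k _ → sumFin-*ˡ (f k) (λ i → s i (n ∸ k))))
          (sumBelow-sumFin (λ i k → f k * s i (n ∸ k)) (suc n))

  ⊛-zero : ∀ f z → IsZeroSeries z → IsZeroSeries (f ⊛ z)
  ⊛-zero f z e n = sumBelow-zero (suc n) (λ k _ → trans (cong (f k *_) (e (n ∸ k))) (zeroʳ _))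

  ⊛-interchange : ∀ a b c d → ((a ⊛ b) ⊛ (c ⊛ d)) ≈ ((a ⊛ c) ⊛ (b ⊛ d))
  ⊛-interchange a b c d = begin
    (a ⊛ b) ⊛ (c ⊛ d)   ≈⟨ ⊛-assoc a b (c ⊛ d) ⟩
    a ⊛ (b ⊛ (c ⊛ d))   ≈⟨ ⊛-congʳ a (≈-sym (⊛-assoc b c d)) ⟩
    a ⊛ ((b ⊛ c) ⊛ d)   ≈⟨ ⊛-congʳ a (⊛-congˡ d (⊛-comm b c)) ⟩
    a ⊛ ((c ⊛ b) ⊛ d)   ≈⟨ ⊛-congʳ a (⊛-assoc c b d) ⟩
    a ⊛ (c ⊛ (b ⊛ d))   ≈⟨ ≈-sym (⊛-assoc a c (b ⊛ d)) ⟩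
    (a ⊛ c) ⊛ (b ⊛ d)   ∎
    where open SetoidReasoning seriesSetoid

  ^S-+ : ∀ f a b → (f ^S (a ℕ.+ b)) ≈ ((f ^S a) ⊛ (f ^S b))
  ^S-+ f zero b = ≈-sym (⊛-identityˡ (f ^S b))
  ^S-+ f (suc a) b = ≈-trans (⊛-congʳ f (^S-+ f a b)) (≈-sym (⊛-assoc f (f ^S a) (f ^S b)))

  ^S-⊛ : ∀ f g i → ((f ⊛ g) ^S i) ≈ ((f ^S i) ⊛ (g ^S i))
  ^S-⊛ f g zero = ≈-sym (⊛-identityˡ oneS)
  ^S-⊛ f g (suc i) = ≈-trans (⊛-congʳ (f ⊛ g) (^S-⊛ f g i)) (⊛-interchange f g (f ^S i) (g ^S i))

  -- (g·G)^i · g^(d−i) = g^d · G^i  for i ≤ d: clearing the denominator g of G = (g·G)/g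
  ^S-homogenise : ∀ g G {d i} → i ≤ d → (((g ⊛ G) ^S i) ⊛ (g ^S (d ∸ i))) ≈ ((g ^S d) ⊛ (G ^S i))
  ^S-homogenise g G {d} {i} i≤d = begin
    ((g ⊛ G) ^S i) ⊛ (g ^S (d ∸ i))          ≈⟨ ⊛-congˡ (g ^S (d ∸ i)) (^S-⊛ g G i) ⟩
    ((g ^S i) ⊛ (G ^S i)) ⊛ (g ^S (d ∸ i))   ≈⟨ ⊛-congˡ (g ^S (d ∸ i)) (⊛-comm (g ^S i) (G ^S i)) ⟩
    ((G ^S i) ⊛ (g ^S i)) ⊛ (g ^S (d ∸ i))   ≈⟨ ⊛-assoc (G ^S i) (g ^S i) (g ^S (d ∸ i)) ⟩
    (G ^S i) ⊛ ((g ^S i) ⊛ (g ^S (d ∸ i)))   ≈⟨ ⊛-congʳ (G ^S i) (≈-sym (^S-+ g i (d ∸ i))) ⟩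
    (G ^S i) ⊛ (g ^S (i ℕ.+ (d ∸ i)))        ≈⟨ ⊛-congʳ (G ^S i) (mk≈ λ n → cong (λ e → (g ^S e) n) (ℕP.m+[n∸m]≡n i≤d)) ⟩
    (G ^S i) ⊛ (g ^S d)                      ≈⟨ ⊛-comm (G ^S i) (g ^S d) ⟩
    (g ^S d) ⊛ (G ^S i)                      ∎
    where open SetoidReasoning seriesSetoid

  _≈[_]_ : Series → ℕ → Series → Set
  s ≈[ N ] t = ∀ k → k < N → s k ≡ t k

  ⊛-congN : ∀ {f f' g g' N} → f ≈[ N ] f' → g ≈[ N ] g' → (f ⊛ g) ≈[ N ] (f' ⊛ g')
  ⊛-congN e e' k lt = sumBelow-cong (suc k) λ j j<sk →
    cong₂ _*_ (e j (ℕP.≤-<-trans (ℕP.≤-pred j<sk) lt)) (e' (k ∸ j) (ℕP.≤-<-trans (ℕP.m∸n≤m k j) lt))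

  ^S-congN : ∀ {f g N} i → f ≈[ N ] g → (f ^S i) ≈[ N ] (g ^S i)
  ^S-congN zero e k _ = refl
  ^S-congN (suc i) e = ⊛-congN e (^S-congN i e)

  -- The homogenisation  B^d · h(A/B) = Σ_i h_i A^i B^(d−i)  at arbitrary series A, B;
  -- homogenised h a b of Defs is this at the polynomials a, b.
  homogenisedS : ∀ {d} → SPoly d → Series → Series → Series
  homogenisedS {d} h A B = sumFinS (λ i → toSeries (lookup h i) ⊛ ((A ^S toℕ i) ⊛ (B ^S (d ∸ toℕ i))))

  homogenisedS-congN : ∀ {d N} (h : SPoly d) {A A' B B'} → A ≈[ N ] A' → B ≈[ N ] B' →
                       homogenisedS h A B ≈[ N ] homogenisedS h A' B'
  homogenisedS-congN {d} h eA eB k k<N = sumFin-cong λ i →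
    ⊛-congN {toSeries (lookup h i)} (λ _ _ → refl) (⊛-congN (^S-congN (toℕ i) eA) (^S-congN (d ∸ toℕ i) eB)) k k<N

  homogenisedS-clear : ∀ {d} (h : SPoly d) g G → homogenisedS h (g ⊛ G) g ≈ ((g ^S d) ⊛ evalAt h G)
  homogenisedS-clear {d} h g G = ≈-sym (≈-trans (⊛-sumFinS (g ^S d) (λ i → toSeries (lookup h i) ⊛ (G ^S toℕ i))) (mk≈ λ n → sumFin-cong λ i → at (term i) n))
    where
    open SetoidReasoning seriesSetoid
    term : ∀ i → ((g ^S d) ⊛ (toSeries (lookup h i) ⊛ (G ^S toℕ i))) ≈
                 (toSeries (lookup h i) ⊛ (((g ⊛ G) ^S toℕ i) ⊛ (g ^S (d ∸ toℕ i))))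
    term i = begin
      gd ⊛ (H ⊛ Gi)    ≈⟨ ≈-sym (⊛-assoc gd H Gi) ⟩
      (gd ⊛ H) ⊛ Gi    ≈⟨ ⊛-congˡ Gi (⊛-comm gd H) ⟩
      (H ⊛ gd) ⊛ Gi    ≈⟨ ⊛-assoc H gd Gi ⟩
      H ⊛ (gd ⊛ Gi)    ≈⟨ ⊛-congʳ H (≈-sym (^S-homogenise g G (FinP.toℕ≤pred[n] i))) ⟩
      H ⊛ (((g ⊛ G) ^S toℕ i) ⊛ (g ^S (d ∸ toℕ i))) ∎
      where
      gd H Gi : Series
      gd = g ^S d
      H = toSeries (lookup h i)
      Gi = G ^S toℕ i

  -- Deg≤ D s says that s is a polynomial of degree at most D; an integer
  -- D is allowed, D < 0 meaning s = 0.  Degrees add under products and sums, and the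
  -- coefficients h_i of h satisfy deg h_i ≤ M + i.

  Deg≤ : ℤ → Series → Set
  Deg≤ D s = ∀ k → D ℤ.< ℤ.+ k → s k ≡ 0#

  Deg≤-mono : ∀ {D D' s} → D ≤ℤ D' → Deg≤ D s → Deg≤ D' s
  Deg≤-mono D≤D' deg k lt = deg k (ℤP.≤-<-trans D≤D' lt)

  Deg≤-oneS : Deg≤ 0ℤ oneS
  Deg≤-oneS zero (ℤ.+<+ ())
  Deg≤-oneS (suc k) _ = refl

  Deg≤-⊛ : ∀ {A B s t} → Deg≤ A s → Deg≤ B t → Deg≤ (A ℤ.+ B) (s ⊛ t)
  Deg≤-⊛ {A} {B} {s} {t} degS degT n lt = sumBelow-zero (suc n) term
    where
    term : ∀ k → k < suc n → s k * t (n ∸ k) ≡ 0#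
    term k k<sn with A ℤP.<? ℤ.+ k
    ... | yes A<k = trans (cong (_* t (n ∸ k)) (degS k A<k)) (zeroˡ _)
    ... | no A≮k = trans (cong (s k *_) (degT (n ∸ k) B<n∸k)) (zeroʳ _)
      where
      n≡k+[n∸k] : ℤ.+ n ≡ ℤ.+ k ℤ.+ ℤ.+ (n ∸ k)
      n≡k+[n∸k] = cong ℤ.+_ (sym (ℕP.m+[n∸m]≡n (ℕP.≤-pred k<sn)))
      identity : ∀ A B K R → R ℤ.- (ℤ.+ 1 ℤ.+ B) ≡ ((K ℤ.+ R) ℤ.- (ℤ.+ 1 ℤ.+ (A ℤ.+ B))) ℤ.+ (A ℤ.- K)
      identity = solve-∀
      B<n∸k : B ℤ.< ℤ.+ (n ∸ k)
      B<n∸k = ℤP.suc[i]≤j⇒i<j (≤-byDifference _ _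
                (ℤP.i≤j⇒0≤j-i (ℤP.i<j⇒suc[i]≤j (subst (A ℤ.+ B ℤ.<_) n≡k+[n∸k] lt)))
                (ℤP.i≤j⇒0≤j-i (ℤP.≮⇒≥ A≮k)) (identity A B (ℤ.+ k) (ℤ.+ (n ∸ k))))

  Deg≤-^S : ∀ {A s} → Deg≤ A s → ∀ i → Deg≤ (ℤ.+ i ℤ.* A) (s ^S i)
  Deg≤-^S {A} deg zero = Deg≤-mono (ℤP.≤-reflexive (sym (ℤP.*-zeroˡ A))) Deg≤-oneS
  Deg≤-^S {A} deg (suc i) = Deg≤-mono (ℤP.≤-reflexive (identity A (ℤ.+ i))) (Deg≤-⊛ deg (Deg≤-^S deg i))
    where
    identity : ∀ A I → A ℤ.+ I ℤ.* A ≡ (ℤ.+ 1 ℤ.+ I) ℤ.* A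
    identity = solve-∀

  Deg≤-sumFinS : ∀ {m D} {s : Fin m → Series} → (∀ i → Deg≤ D (s i)) → Deg≤ D (sumFinS s)
  Deg≤-sumFinS deg k lt = sumFin-zero (λ i → deg i k lt)

  truncate : ℕ → Series → Poly
  truncate zero s = []
  truncate (suc K) s = s 0 ∷ truncate K (λ k → s (suc k))

  truncate-below : ∀ K s k → k < K → toSeries (truncate K s) k ≡ s k
  truncate-below (suc K) s zero lt = refl
  truncate-below (suc K) s (suc k) (s≤s lt) = truncate-below K (λ k → s (suc k)) k lt

  truncate-above : ∀ K s k → K ≤ k → toSeries (truncate K s) k ≡ 0#
  truncate-above zero s k le = refl
  truncate-above (suc K) s (suc k) (s≤s le) = truncate-above K (λ k → s (suc k)) k le

  Deg≤-truncate : ∀ K s → Deg≤ (ℤ.+ K ℤ.- ℤ.+ 1) (toSeries (truncate K s))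
  Deg≤-truncate K s k lt =
    truncate-above K s k (ℤP.drop‿+≤+ (subst (ℤ._≤ ℤ.+ k) (identity (ℤ.+ K)) (ℤP.i<j⇒suc[i]≤j lt)))
    where
    identity : ∀ X → ℤ.+ 1 ℤ.+ (X ℤ.- ℤ.+ 1) ≡ X
    identity = solve-∀

  DegreeSpec : Poly → Maybe ℕ → Set
  DegreeSpec p nothing = ∀ k → toSeries p k ≡ 0#
  DegreeSpec p (just e) = ∀ k → e < k → toSeries p k ≡ 0#

  deg-spec : ∀ p → DegreeSpec p (deg p)
  deg-spec [] = λ k → refl
  deg-spec (c ∷ cs) with deg cs | deg-spec cs
  ... | just e | spec = λ { zero () ; (suc k) (s≤s lt) → spec k lt }
  ... | nothing | spec with c ≟ 0#
  ...   | yes c≡0 = λ { zero → c≡0 ; (suc k) → spec k }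
  ...   | no _ = λ { zero () ; (suc k) _ → spec k }

  AtLeast : ℤ → Maybe ℤ → Set
  AtLeast v nothing = ⊥
  AtLeast v (just w) = v ≤ℤ w

  maxM-atLeastˡ : ∀ {v} x y → AtLeast v x → AtLeast v (maxM x y)
  maxM-atLeastˡ (just x) nothing v≤x = v≤x
  maxM-atLeastˡ (just x) (just y) v≤x = ℤP.≤-trans v≤x (ℤP.i≤i⊔j x y)

  maxM-atLeastʳ : ∀ {v} x y → AtLeast v y → AtLeast v (maxM x y)
  maxM-atLeastʳ nothing (just y) v≤y = v≤y
  maxM-atLeastʳ (just x) (just y) v≤y = ℤP.≤-trans v≤y (ℤP.i≤j⊔i x y)

  maxFin-atLeast : ∀ {n} (f : Fin n → Maybe ℤ) i {v} → f i ≡ just v → AtLeast v (maxFin f)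
  maxFin-atLeast f Fin.zero eq =
    maxM-atLeastˡ (f Fin.zero) _ (subst (AtLeast _) (sym eq) ℤP.≤-refl)
  maxFin-atLeast f (Fin.suc i) eq =
    maxM-atLeastʳ (f Fin.zero) _ (maxFin-atLeast (λ j → f (Fin.suc j)) i eq)

  coefficient-degree : ∀ {d} (h : SPoly d) {M} → Mof h ≡ just M →
                       ∀ i → Deg≤ (M ℤ.+ ℤ.+ toℕ i) (toSeries (lookup h i))
  coefficient-degree h {M} Mof≡M i with deg (lookup h i) in degEq | deg-spec (lookup h i)
  ... | nothing | spec = λ k _ → spec k
  ... | just e  | spec = λ k lt → spec k (ℤP.drop‿+<+ (ℤP.≤-<-trans e≤M+i lt))
    where
    e-i≤M : ℤ.+ e ℤ.- ℤ.+ toℕ i ≤ℤ M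
    e-i≤M = subst (AtLeast _) Mof≡M
      (maxFin-atLeast (λ j → Maybe.map (λ k → ℤ.+ k ℤ.- ℤ.+ toℕ j) (deg (lookup h j))) i
                      (cong (Maybe.map (λ k → ℤ.+ k ℤ.- ℤ.+ toℕ i)) degEq))
    identity : ∀ E I M → (M ℤ.+ I) ℤ.- E ≡ (M ℤ.- (E ℤ.- I)) ℤ.+ 0ℤ
    identity = solve-∀
    e≤M+i : ℤ.+ e ≤ℤ M ℤ.+ ℤ.+ toℕ i
    e≤M+i = ≤-byDifference _ 0ℤ (ℤP.i≤j⇒0≤j-i e-i≤M) ℤP.≤-refl (identity (ℤ.+ e) (ℤ.+ toℕ i) M)

  homogenisedS-degree : ∀ {d} (h : SPoly d) {M} → Mof h ≡ just M → ∀ ℓ {A B} →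
    Deg≤ (ℤ.+ ℓ ℤ.- ℤ.+ 1) A → Deg≤ (ℤ.+ ℓ) B → Deg≤ (M ℤ.+ ℤ.+ d ℤ.* ℤ.+ ℓ) (homogenisedS h A B)
  homogenisedS-degree {d} h {M} Mof≡M ℓ degA degB = Deg≤-sumFinS λ i →
    Deg≤-mono (ℤP.≤-reflexive (total i))
      (Deg≤-⊛ (coefficient-degree h Mof≡M i) (Deg≤-⊛ (Deg≤-^S degA (toℕ i)) (Deg≤-^S degB (d ∸ toℕ i))))
    where
    identity : ∀ M I L D → (M ℤ.+ I) ℤ.+ (I ℤ.* (L ℤ.- ℤ.+ 1) ℤ.+ (D ℤ.- I) ℤ.* L) ≡ M ℤ.+ D ℤ.* L
    identity = solve-∀
    total : ∀ i → (M ℤ.+ ℤ.+ toℕ i) ℤ.+ (ℤ.+ toℕ i ℤ.* (ℤ.+ ℓ ℤ.- ℤ.+ 1) ℤ.+ ℤ.+ (d ∸ toℕ i) ℤ.* ℤ.+ ℓ) ≡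
                  M ℤ.+ ℤ.+ d ℤ.* ℤ.+ ℓ
    total i = trans (cong (λ z → (M ℤ.+ ℤ.+ toℕ i) ℤ.+ (ℤ.+ toℕ i ℤ.* (ℤ.+ ℓ ℤ.- ℤ.+ 1) ℤ.+ z ℤ.* ℤ.+ ℓ)) d∸i)
                    (identity M (ℤ.+ toℕ i) (ℤ.+ ℓ) (ℤ.+ d))
      where
      d∸i : ℤ.+ (d ∸ toℕ i) ≡ ℤ.+ d ℤ.- ℤ.+ toℕ i
      d∸i = sym (trans (ℤP.m-n≡m⊖n d (toℕ i)) (ℤP.⊖-≥ (FinP.toℕ≤pred[n] i)))

  module Recurrences (u : ℕ → Carrier) where
    open ≡-Reasoning

    discrepancy : (ℕ → Carrier) → ℕ → ℕ → Carrier
    discrepancy a K n = sumBelow (λ j → a j * u (n ℕ.+ j)) K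

    record Annihilator (N ℓ : ℕ) (a : ℕ → Carrier) : Set where
      constructor annihilator
      field
        leading     : a ℓ ≡ 1#
        beyond      : ∀ j → ℓ < j → a j ≡ 0#
        annihilates : ∀ n → n ℕ.+ ℓ < N → discrepancy a (suc ℓ) n ≡ 0#

    HasAnnihilator : ℕ → ℕ → Set
    HasAnnihilator N ℓ = Σ (ℕ → Carrier) (Annihilator N ℓ)

    -- the monic vector (−c_0, …, −c_{ℓ−1}, 1, 0, 0, …) of the recurrence u_{n+ℓ} = Σ_j c_j u_{n+j}
    monic : ∀ {ℓ} → (Fin ℓ → Carrier) → ℕ → Carrier
    monic {zero} c zero = 1#
    monic {zero} c (suc j) = 0#
    monic {suc ℓ} c zero = - c Fin.zero
    monic {suc ℓ} c (suc j) = monic (λ i → c (Fin.suc i)) j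

    monic-leading : ∀ {ℓ} (c : Fin ℓ → Carrier) → monic c ℓ ≡ 1#
    monic-leading {zero} c = refl
    monic-leading {suc ℓ} c = monic-leading (λ i → c (Fin.suc i))

    monic-beyond : ∀ {ℓ} (c : Fin ℓ → Carrier) j → ℓ < j → monic c j ≡ 0#
    monic-beyond {zero} c (suc j) _ = refl
    monic-beyond {suc ℓ} c (suc j) (s≤s lt) = monic-beyond (λ i → c (Fin.suc i)) j lt

    monic-sum : ∀ {ℓ} (c : Fin ℓ → Carrier) (x : ℕ → Carrier) →
                sumBelow (λ j → monic c j * x j) (suc ℓ) ≡ x ℓ + - sumFin (λ j → c j * x (toℕ j))
    monic-sum {zero} c x = begin
      0# + 1# * x 0   ≡⟨ +-identityˡ _ ⟩
      1# * x 0        ≡⟨ *-identityˡ _ ⟩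
      x 0             ≡⟨ sym (+-identityʳ _) ⟩
      x 0 + 0#        ≡⟨ cong (x 0 +_) (sym -0#≈0#) ⟩
      x 0 + - 0#      ∎
    monic-sum {suc ℓ} c x = begin
      sumBelow (λ j → monic c j * x j) (suc (suc ℓ))
        ≡⟨ sumBelow-head _ (suc ℓ) ⟩
      - c₀ * x 0 + sumBelow (λ j → monic c' j * x (suc j)) (suc ℓ)
        ≡⟨ cong₂ _+_ (sym (-‿distribˡ-* c₀ (x 0))) (monic-sum c' (λ j → x (suc j))) ⟩
      - (c₀ * x 0) + (x (suc ℓ) + - S)
        ≡⟨ sym (+-assoc _ _ _) ⟩
      (- (c₀ * x 0) + x (suc ℓ)) + - S
        ≡⟨ cong (_+ - S) (+-comm _ _) ⟩
      (x (suc ℓ) + - (c₀ * x 0)) + - S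
        ≡⟨ +-assoc _ _ _ ⟩
      x (suc ℓ) + (- (c₀ * x 0) + - S)
        ≡⟨ cong (x (suc ℓ) +_) (-‿+-comm _ _) ⟩
      x (suc ℓ) + - (c₀ * x 0 + S) ∎
      where
      c₀ : Carrier
      c₀ = c Fin.zero
      c' : Fin ℓ → Carrier
      c' i = c (Fin.suc i)
      S : Carrier
      S = sumFin (λ j → c' j * x (suc (toℕ j)))

    fromHasRecurrence : ∀ {N ℓ} → HasRecurrence u N ℓ → HasAnnihilator N ℓ
    fromHasRecurrence {N} {ℓ} (c , recurrence) = monic c , annihilator (monic-leading c) (monic-beyond c) vanish
      where
      vanish : ∀ n → n ℕ.+ ℓ < N → discrepancy (monic c) (suc ℓ) n ≡ 0#
      vanish n lt = begin
        discrepancy (monic c) (suc ℓ) n   ≡⟨ monic-sum c (λ j → u (n ℕ.+ j)) ⟩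
        u (n ℕ.+ ℓ) + - S                 ≡⟨ cong (_+ - S) (recurrence n lt) ⟩
        S + - S                           ≡⟨ -‿inverseʳ S ⟩
        0#                                ∎
        where
        S : Carrier
        S = sumFin (λ j → c j * u (n ℕ.+ toℕ j))

    toHasRecurrence : ∀ {N ℓ a} → Annihilator N ℓ a → HasRecurrence u N ℓ
    toHasRecurrence {N} {ℓ} {a} (annihilator leading _ annihilates) = (λ j → - a (toℕ j)) , solve
      where
      solve : ∀ n → n ℕ.+ ℓ < N → u (n ℕ.+ ℓ) ≡ sumFin {ℓ} (λ j → - a (toℕ j) * u (n ℕ.+ toℕ j))
      solve n lt = begin
        u (n ℕ.+ ℓ)                                ≡⟨ +-inverseʳ-unique S _ S+u≡0 ⟩
        - S                                        ≡⟨ sym (sumBelow-neg _ ℓ) ⟩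
        sumBelow (λ j → - (a j * u (n ℕ.+ j))) ℓ    ≡⟨ sumBelow-cong ℓ (λ j _ → -‿distribˡ-* _ _) ⟩
        sumBelow (λ j → - a j * u (n ℕ.+ j)) ℓ      ≡⟨ sym (sumFin-toℕ ℓ (λ j → - a j * u (n ℕ.+ j))) ⟩
        sumFin {ℓ} (λ j → - a (toℕ j) * u (n ℕ.+ toℕ j)) ∎
        where
        S : Carrier
        S = discrepancy a ℓ n
        S+u≡0 : S + u (n ℕ.+ ℓ) ≡ 0#
        S+u≡0 = trans (cong (S +_) (sym (trans (cong (_* _) leading) (*-identityˡ _)))) (annihilates n lt)

    -- any vector of length ℓ annihilates u below ℓ, since no position is constrained
    trivialAnnihilator : ∀ ℓ → HasAnnihilator ℓ ℓ
    trivialAnnihilator ℓ =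
      fromHasRecurrence ((λ _ → 0#) , λ n lt → ⊥-elim (ℕP.<-irrefl refl (ℕP.≤-<-trans (ℕP.m≤n+m ℓ n) lt)))

    annihilator-extend : ∀ {N ℓ a} → Annihilator N ℓ a →
      (∀ n → n ℕ.+ ℓ ≡ N → discrepancy a (suc ℓ) n ≡ 0#) → Annihilator (suc N) ℓ a
    annihilator-extend {N} {ℓ} {a} (annihilator leading beyond annihilates) atN = annihilator leading beyond extended
      where
      extended : ∀ n → n ℕ.+ ℓ < suc N → discrepancy a (suc ℓ) n ≡ 0#
      extended n lt with ℕP.m≤n⇒m<n∨m≡n (ℕP.≤-pred lt)
      ... | inj₁ below = annihilates n below
      ... | inj₂ at = atN n at

    -- x^s · a: the vector a moved up by s places
    shift : ℕ → (ℕ → Carrier) → ℕ → Carrier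
    shift zero a j = a j
    shift (suc s) a zero = 0#
    shift (suc s) a (suc j) = shift s a j

    shift-below : ∀ s a j → j < s → shift s a j ≡ 0#
    shift-below (suc s) a zero _ = refl
    shift-below (suc s) a (suc j) (s≤s lt) = shift-below s a j lt

    shift-above : ∀ s a j → s ≤ j → shift s a j ≡ a (j ∸ s)
    shift-above zero a j _ = refl
    shift-above (suc s) a (suc j) (s≤s le) = shift-above s a j le

    shift-+ : ∀ s a i → shift s a (s ℕ.+ i) ≡ a i
    shift-+ zero a i = refl
    shift-+ (suc s) a i = shift-+ s a i

    discrepancy-shift : ∀ s a K n → discrepancy (shift s a) (s ℕ.+ K) n ≡ discrepancy a K (n ℕ.+ s)
    discrepancy-shift s a K n = begin
      discrepancy (shift s a) (s ℕ.+ K) n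
        ≡⟨ sumBelow-split _ s K ⟩
      sumBelow (λ j → shift s a j * u (n ℕ.+ j)) s + sumBelow (λ i → shift s a (s ℕ.+ i) * u (n ℕ.+ (s ℕ.+ i))) K
        ≡⟨ cong₂ _+_ (sumBelow-zero s (λ j j<s → trans (cong (_* _) (shift-below s a j j<s)) (zeroˡ _)))
                     (sumBelow-cong K (λ i _ → cong₂ _*_ (shift-+ s a i) (cong u (sym (ℕP.+-assoc n s i))))) ⟩
      0# + discrepancy a K (n ℕ.+ s)
        ≡⟨ +-identityˡ _ ⟩
      discrepancy a K (n ℕ.+ s) ∎

    discrepancy-beyond : ∀ {ℓ a} → (∀ j → ℓ < j → a j ≡ 0#) → ∀ K n → ℓ < K →
                         discrepancy a K n ≡ discrepancy a (suc ℓ) n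
    discrepancy-beyond beyond K n ℓ<K =
      sumBelow-truncate _ K ℓ<K (λ j ℓ<j → trans (cong (_* _) (beyond j ℓ<j)) (zeroˡ _))

    discrepancy-combine : ∀ x y c K n →
      discrepancy (λ j → x j + - (c * y j)) K n ≡ discrepancy x K n + - (c * discrepancy y K n)
    discrepancy-combine x y c K n = begin
      sumBelow (λ j → (x j + - (c * y j)) * u (n ℕ.+ j)) K
        ≡⟨ sumBelow-cong K (λ j _ → trans (distribʳ _ _ _) (cong (x j * u (n ℕ.+ j) +_)
             (trans (sym (-‿distribˡ-* _ _)) (cong -_ (*-assoc c (y j) _))))) ⟩
      sumBelow (λ j → x j * u (n ℕ.+ j) + - (c * (y j * u (n ℕ.+ j)))) K
        ≡⟨ sumBelow-+ _ _ K ⟩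
      discrepancy x K n + sumBelow (λ j → - (c * (y j * u (n ℕ.+ j)))) K
        ≡⟨ cong (discrepancy x K n +_) (trans (sumBelow-neg _ K) (cong -_ (sym (sumBelow-*ˡ c _ K)))) ⟩
      discrepancy x K n + - (c * discrepancy y K n) ∎

    -- Let a (degree ℓ, valid below N) fail at N = n₀ + ℓ with
    -- discrepancy δ, and let a' (degree ℓ', valid below n' + ℓ') fail at n' + ℓ' with
    -- discrepancy δ', where δ = c·δ'.  With k = N − n' > ℓ' and shifts aligning the
    -- leading terms (s₁ + ℓ = s₂ + k), the combination x^{s₁}a − c·x^{s₂}a' keeps every
    -- relation below N and cancels the failure at N, so it is valid below N + 1.
    massey-update : ∀ {N n₀ ℓ a n' ℓ' a'} (s₁ s₂ k : ℕ) →
      Annihilator N ℓ a → Annihilator (n' ℕ.+ ℓ') ℓ' a' →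
      n₀ ℕ.+ ℓ ≡ N → k ℕ.+ n' ≡ N → ℓ' < k → s₁ ℕ.+ ℓ ≡ s₂ ℕ.+ k →
      (c : Carrier) → c * discrepancy a' (suc ℓ') n' ≡ discrepancy a (suc ℓ) n₀ →
      Annihilator (suc N) (s₁ ℕ.+ ℓ) (λ j → shift s₁ a j + - (c * shift s₂ a' j))
    massey-update {N} {n₀} {ℓ} {a} {n'} {ℓ'} {a'} s₁ s₂ k
                  (annihilator leading beyond annihilates) (annihilator _ beyond' annihilates')
                  n₀+ℓ≡N k+n'≡N ℓ'<k aligned c cδ'≡δ =
      annihilator newLeading newBeyond newAnnihilates
      where
      c*0 : ∀ x → x + - (c * 0#) ≡ x
      c*0 x = trans (cong (λ z → x + - z) (zeroʳ c)) (trans (cong (x +_) -0#≈0#) (+-identityʳ x))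

      below-shifted : ∀ s x j → s ℕ.+ x < j → x < j ∸ s
      below-shifted s x j lt = subst (_< j ∸ s) (ℕP.m+n∸m≡n s x) (ℕP.∸-monoˡ-< lt (ℕP.m≤m+n s x))

      newLeading : shift s₁ a (s₁ ℕ.+ ℓ) + - (c * shift s₂ a' (s₁ ℕ.+ ℓ)) ≡ 1#
      newLeading = begin
        shift s₁ a (s₁ ℕ.+ ℓ) + - (c * shift s₂ a' (s₁ ℕ.+ ℓ))
          ≡⟨ cong₂ (λ p q → p + - (c * q)) (trans (shift-+ s₁ a ℓ) leading)
                   (trans (cong (shift s₂ a') aligned) (trans (shift-+ s₂ a' k) (beyond' k ℓ'<k))) ⟩
        1# + - (c * 0#)
          ≡⟨ c*0 1# ⟩
        1# ∎

      newBeyond : ∀ j → s₁ ℕ.+ ℓ < j → shift s₁ a j + - (c * shift s₂ a' j) ≡ 0#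
      newBeyond j lt = trans (cong₂ (λ p q → p + - (c * q))
          (trans (shift-above s₁ a j (ℕP.≤-trans (ℕP.m≤m+n s₁ ℓ) (ℕP.<⇒≤ lt))) (beyond _ (below-shifted s₁ ℓ j lt)))
          (trans (shift-above s₂ a' j (ℕP.≤-trans (ℕP.m≤m+n s₂ k) (ℕP.<⇒≤ lt₂)))
                 (beyond' _ (ℕP.<-trans ℓ'<k (below-shifted s₂ k j lt₂)))))
          (c*0 0#)
        where
        lt₂ : s₂ ℕ.+ k < j
        lt₂ = subst (_< j) aligned lt

      combined : ∀ n → discrepancy (λ j → shift s₁ a j + - (c * shift s₂ a' j)) (suc (s₁ ℕ.+ ℓ)) n ≡
                       discrepancy a (suc ℓ) (n ℕ.+ s₁) + - (c * discrepancy a' (suc ℓ') (n ℕ.+ s₂))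
      combined n = begin
        discrepancy (λ j → shift s₁ a j + - (c * shift s₂ a' j)) (suc (s₁ ℕ.+ ℓ)) n
          ≡⟨ discrepancy-combine (shift s₁ a) (shift s₂ a') c (suc (s₁ ℕ.+ ℓ)) n ⟩
        discrepancy (shift s₁ a) (suc (s₁ ℕ.+ ℓ)) n + - (c * discrepancy (shift s₂ a') (suc (s₁ ℕ.+ ℓ)) n)
          ≡⟨ cong₂ (λ p q → p + - (c * q))
               (trans (cong (λ z → discrepancy (shift s₁ a) z n) (sym (ℕP.+-suc s₁ ℓ))) (discrepancy-shift s₁ a (suc ℓ) n))
               (trans (cong (λ z → discrepancy (shift s₂ a') z n) (trans (cong suc aligned) (sym (ℕP.+-suc s₂ k))))
                      (trans (discrepancy-shift s₂ a' (suc k) n)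
                             (discrepancy-beyond beyond' (suc k) (n ℕ.+ s₂) (ℕP.m<n⇒m<1+n ℓ'<k)))) ⟩
        discrepancy a (suc ℓ) (n ℕ.+ s₁) + - (c * discrepancy a' (suc ℓ') (n ℕ.+ s₂)) ∎

      newAnnihilates : ∀ n → n ℕ.+ (s₁ ℕ.+ ℓ) < suc N →
        discrepancy (λ j → shift s₁ a j + - (c * shift s₂ a' j)) (suc (s₁ ℕ.+ ℓ)) n ≡ 0#
      newAnnihilates n lt = trans (combined n) (cases (ℕP.m≤n⇒m<n∨m≡n (ℕP.≤-pred lt)))
        where
        first : (n ℕ.+ s₁) ℕ.+ ℓ ≡ n ℕ.+ (s₁ ℕ.+ ℓ)
        first = ℕP.+-assoc n s₁ ℓ
        second : (n ℕ.+ s₂) ℕ.+ k ≡ n ℕ.+ (s₁ ℕ.+ ℓ)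
        second = trans (ℕP.+-assoc n s₂ k) (cong (n ℕ.+_) (sym aligned))
        N≡n'+k : N ≡ n' ℕ.+ k
        N≡n'+k = trans (sym k+n'≡N) (ℕP.+-comm k n')
        cases : n ℕ.+ (s₁ ℕ.+ ℓ) < N ⊎ n ℕ.+ (s₁ ℕ.+ ℓ) ≡ N →
                discrepancy a (suc ℓ) (n ℕ.+ s₁) + - (c * discrepancy a' (suc ℓ') (n ℕ.+ s₂)) ≡ 0#
        -- strictly below N both old relations hold
        cases (inj₁ below) = trans (cong₂ (λ p q → p + - (c * q))
            (annihilates _ (subst (_< N) (sym first) below))
            (annihilates' _ (ℕP.+-monoˡ-< ℓ' (ℕP.+-cancelʳ-< k (n ℕ.+ s₂) n'
              (subst (_< n' ℕ.+ k) (sym second) (subst (n ℕ.+ (s₁ ℕ.+ ℓ) <_) N≡n'+k below))))))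
          (c*0 0#)
        -- at N both old relations fail, and the failures cancel
        cases (inj₂ atN) = begin
          discrepancy a (suc ℓ) (n ℕ.+ s₁) + - (c * discrepancy a' (suc ℓ') (n ℕ.+ s₂))
            ≡⟨ cong₂ (λ p q → discrepancy a (suc ℓ) p + - (c * discrepancy a' (suc ℓ') q))
                 (ℕP.+-cancelʳ-≡ ℓ _ _ (trans first (trans atN (sym n₀+ℓ≡N))))
                 (ℕP.+-cancelʳ-≡ k _ _ (trans second (trans atN N≡n'+k))) ⟩
          discrepancy a (suc ℓ) n₀ + - (c * discrepancy a' (suc ℓ') n')
            ≡⟨ cong (λ z → discrepancy a (suc ℓ) n₀ + - z) cδ'≡δ ⟩
          discrepancy a (suc ℓ) n₀ + - discrepancy a (suc ℓ) n₀
            ≡⟨ -‿inverseʳ _ ⟩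
          0# ∎

    module Massey (P : ℕ → ℕ → Set) (P-start : P 0 0) (P-keep : ∀ {N ℓ} → P N ℓ → P (suc N) ℓ)
                  (P-jump : ∀ {N ℓ k} → HasAnnihilator N ℓ → k ℕ.+ ℓ ≤ suc N → P (suc N) k) where

      -- the annihilator in use before the last change of length: it failed at n' + ℓ'
      -- with nonzero discrepancy, and the current length ℓ is at most n' + 1
      record LastFailure (N ℓ : ℕ) : Set where
        constructor lastFailure
        field
          ℓ' n'   : ℕ
          a'      : ℕ → Carrier
          valid'  : Annihilator (n' ℕ.+ ℓ') ℓ' a'
          fails'  : discrepancy a' (suc ℓ') n' ≢ 0#
          earlier : n' ℕ.+ ℓ' < N
          bounded : ℓ ≤ suc n'

      lastFailure-suc : ∀ {N ℓ} → LastFailure N ℓ → LastFailure (suc N) ℓ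
      lastFailure-suc (lastFailure ℓ' n' a' valid' fails' earlier bounded) =
        lastFailure ℓ' n' a' valid' fails' (ℕP.m<n⇒m<1+n earlier) bounded

      record State (N : ℕ) : Set where
        constructor state
        field
          ℓ         : ℕ
          a         : ℕ → Carrier
          valid     : Annihilator N ℓ a
          invariant : P N ℓ
          history   : ℓ ≡ 0 ⊎ LastFailure N ℓ

      failureAt : ∀ {N ℓ a k} → Annihilator N ℓ a → ℓ ≤ N → discrepancy a (suc ℓ) (N ∸ ℓ) ≢ 0# →
                  k ℕ.+ ℓ ≤ suc N → LastFailure (suc N) k
      failureAt {N} {ℓ} {a} {k} valid ℓ≤N fails k+ℓ≤ =
        lastFailure ℓ (N ∸ ℓ) a (subst (λ m → Annihilator m ℓ a) (sym n₀+ℓ≡N) valid) fails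
          (subst (_< suc N) (sym n₀+ℓ≡N) (ℕP.n<1+n N))
          (ℕP.+-cancelʳ-≤ ℓ k (suc (N ∸ ℓ)) (subst (k ℕ.+ ℓ ≤_) (cong suc (sym n₀+ℓ≡N)) k+ℓ≤))
        where
        n₀+ℓ≡N : (N ∸ ℓ) ℕ.+ ℓ ≡ N
        n₀+ℓ≡N = ℕP.m∸n+n≡m ℓ≤N

      keep : ∀ {N} (s : State N) → (∀ n → n ℕ.+ State.ℓ s ≡ N → discrepancy (State.a s) (suc (State.ℓ s)) n ≡ 0#) →
             State (suc N)
      keep (state ℓ a valid invariant history) atN =
        state ℓ a (annihilator-extend valid atN) (P-keep invariant) (map₂ lastFailure-suc history)

      change : ∀ {N} (s : State N) → State.ℓ s ≤ N → discrepancy (State.a s) (suc (State.ℓ s)) (N ∸ State.ℓ s) ≢ 0# →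
               State (suc N)
      -- no earlier failure (ℓ = 0): restart with the trivial annihilator of length N + 1
      change {N} (state ℓ a valid _ (inj₁ ℓ≡0)) ℓ≤N fails =
        state (suc N) (proj₁ trivial) (proj₂ trivial) (P-jump (a , valid) N+1+ℓ≤)
              (inj₂ (failureAt valid ℓ≤N fails N+1+ℓ≤))
        where
        trivial : HasAnnihilator (suc N) (suc N)
        trivial = trivialAnnihilator (suc N)
        N+1+ℓ≤ : suc N ℕ.+ ℓ ≤ suc N
        N+1+ℓ≤ = ℕP.≤-reflexive (trans (cong (suc N ℕ.+_) ℓ≡0) (ℕP.+-identityʳ (suc N)))
      -- otherwise combine with the last failing annihilator; the length becomes max(ℓ, k)
      change {N} (state ℓ a valid invariant (inj₂ last)) ℓ≤N fails = combine (k ℕ.≤? ℓ)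
        where
        open LastFailure last
        n'≤N : n' ≤ N
        n'≤N = ℕP.≤-trans (ℕP.m≤m+n n' ℓ') (ℕP.<⇒≤ earlier)
        k : ℕ
        k = N ∸ n'
        k+n'≡N : k ℕ.+ n' ≡ N
        k+n'≡N = ℕP.m∸n+n≡m n'≤N
        ℓ'<k : ℓ' < k
        ℓ'<k = ℕP.+-cancelˡ-< n' ℓ' k (subst (n' ℕ.+ ℓ' <_) (trans (sym k+n'≡N) (ℕP.+-comm k n')) earlier)
        n₀+ℓ≡N : (N ∸ ℓ) ℕ.+ ℓ ≡ N
        n₀+ℓ≡N = ℕP.m∸n+n≡m ℓ≤N
        δ δ' δ'⁻¹ c : Carrier
        δ = discrepancy a (suc ℓ) (N ∸ ℓ)
        δ' = discrepancy a' (suc ℓ') n'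
        δ'⁻¹ = proj₁ (inverse δ' fails')
        c = δ * δ'⁻¹
        cδ'≡δ : c * δ' ≡ δ
        cδ'≡δ = trans (*-assoc δ δ'⁻¹ δ')
                  (trans (cong (δ *_) (trans (*-comm δ'⁻¹ δ') (proj₂ (inverse δ' fails')))) (*-identityʳ δ))
        combine : Dec (k ≤ ℓ) → State (suc N)
        -- k ≤ ℓ: shift a' up to the length ℓ, which is kept
        combine (yes k≤ℓ) =
          state ℓ _ (massey-update 0 (ℓ ∸ k) k valid valid' n₀+ℓ≡N k+n'≡N ℓ'<k (sym (ℕP.m∸n+n≡m k≤ℓ)) c cδ'≡δ)
                (P-keep invariant) (inj₂ (lastFailure-suc last))
        -- ℓ < k: shift a up to the new length k, and remember the failure of a
        combine (no k≰ℓ) =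
          state k _ (subst (λ m → Annihilator (suc N) m (λ j → shift (k ∸ ℓ) a j + - (c * shift 0 a' j))) k∸ℓ+ℓ≡k
                      (massey-update (k ∸ ℓ) 0 k valid valid' n₀+ℓ≡N k+n'≡N ℓ'<k k∸ℓ+ℓ≡k c cδ'≡δ))
                (P-jump (a , valid) k+ℓ≤) (inj₂ (failureAt valid ℓ≤N fails k+ℓ≤))
          where
          k∸ℓ+ℓ≡k : (k ∸ ℓ) ℕ.+ ℓ ≡ k
          k∸ℓ+ℓ≡k = ℕP.m∸n+n≡m (ℕP.<⇒≤ (ℕP.≰⇒> k≰ℓ))
          k+ℓ≤ : k ℕ.+ ℓ ≤ suc N
          k+ℓ≤ = ℕP.≤-trans (ℕP.+-monoʳ-≤ k bounded) (ℕP.≤-reflexive (trans (ℕP.+-suc k n') (cong suc k+n'≡N)))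

      step : ∀ {N} → State N → State (suc N)
      step {N} s with State.ℓ s ℕ.≤? N
      ... | no ℓ≰N = keep s (λ n n+ℓ≡N → ⊥-elim (ℓ≰N (subst (State.ℓ s ≤_) n+ℓ≡N (ℕP.m≤n+m _ n))))
      ... | yes ℓ≤N with discrepancy (State.a s) (suc (State.ℓ s)) (N ∸ State.ℓ s) ≟ 0#
      ...   | yes agrees = keep s (λ n n+ℓ≡N →
                subst (λ m → discrepancy (State.a s) (suc (State.ℓ s)) m ≡ 0#)
                      (ℕP.+-cancelʳ-≡ (State.ℓ s) _ _ (trans (ℕP.m∸n+n≡m ℓ≤N) (sym n+ℓ≡N))) agrees)
      ...   | no fails = change s ℓ≤N fails

      states : ∀ N → State N
      states zero = state 0 (proj₁ (trivialAnnihilator 0)) (proj₂ (trivialAnnihilator 0)) P-start (inj₁ refl)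
      states (suc N) = step (states N)

      massey : ∀ N → Σ ℕ λ ℓ → HasAnnihilator N ℓ × P N ℓ
      massey N = State.ℓ s , (State.a s , State.valid s) , State.invariant s
        where
        s : State N
        s = states N

  module LowerBound (u : Series) {d : ℕ} (h : SPoly d) (hG≡0 : IsZeroSeries (evalAt h u))
                    (noRoot : NoRationalRoot h) {M : ℤ} (Mof≡M : Mof h ≡ just M) where
    open Recurrences u
    open ≡-Reasoning

    reversed : ℕ → (ℕ → Carrier) → Series
    reversed ℓ a k with k ℕ.≤? ℓ
    ... | yes _ = a (ℓ ∸ k)
    ... | no _ = 0#

    reversed-below : ∀ ℓ a k → k ≤ ℓ → reversed ℓ a k ≡ a (ℓ ∸ k)
    reversed-below ℓ a k k≤ℓ with k ℕ.≤? ℓ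
    ... | yes _ = refl
    ... | no k≰ℓ = ⊥-elim (k≰ℓ k≤ℓ)

    reversed-above : ∀ ℓ a k → ℓ < k → reversed ℓ a k ≡ 0#
    reversed-above ℓ a k ℓ<k with k ℕ.≤? ℓ
    ... | yes k≤ℓ = ⊥-elim (ℕP.<⇒≱ ℓ<k k≤ℓ)
    ... | no _ = refl

    reversed-⊛ : ∀ ℓ a n → (reversed ℓ a ⊛ u) (n ℕ.+ ℓ) ≡ discrepancy a (suc ℓ) n
    reversed-⊛ ℓ a n = begin
      sumBelow term (suc (n ℕ.+ ℓ))               ≡⟨ cong (λ m → sumBelow term (suc m)) (ℕP.+-comm n ℓ) ⟩
      sumBelow term (suc (ℓ ℕ.+ n))               ≡⟨ sumBelow-truncate (suc ℓ) (suc (ℓ ℕ.+ n)) (s≤s (ℕP.m≤m+n ℓ n))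
                                                      (λ k ℓ<k → trans (cong (_* _) (reversed-above ℓ a k ℓ<k)) (zeroˡ _)) ⟩
      sumBelow term (suc ℓ)                       ≡⟨ sumBelow-reverse term (suc ℓ) ⟩
      sumBelow (λ j → term (ℓ ∸ j)) (suc ℓ)       ≡⟨ sumBelow-cong (suc ℓ) reindex ⟩
      discrepancy a (suc ℓ) n                     ∎
      where
      term : ℕ → Carrier
      term k = reversed ℓ a k * u ((n ℕ.+ ℓ) ∸ k)
      reindex : ∀ j → j < suc ℓ → term (ℓ ∸ j) ≡ a j * u (n ℕ.+ j)
      reindex j j<sℓ = cong₂ _*_
        (trans (reversed-below ℓ a (ℓ ∸ j) (ℕP.m∸n≤m ℓ j)) (cong a (ℕP.m∸[m∸n]≡n j≤ℓ)))
        (cong u (trans (ℕP.+-∸-assoc n (ℕP.m∸n≤m ℓ j)) (cong (n ℕ.+_) (ℕP.m∸[m∸n]≡n j≤ℓ))))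
        where
        j≤ℓ : j ≤ ℓ
        j≤ℓ = ℕP.≤-pred j<sℓ

    lower-bound : ∀ {N ℓ} → HasAnnihilator N ℓ → ℤ.+ N ℤ.- M ≤ℤ ℤ.+ d ℤ.* ℤ.+ ℓ
    lower-bound {N} {ℓ} (a , annihilator leading _ annihilates) with (ℤ.+ N ℤ.- M) ℤP.≤? (ℤ.+ d ℤ.* ℤ.+ ℓ)
    ... | yes N-M≤dℓ = N-M≤dℓ
    ... | no N-M≰dℓ = ⊥-elim (noRoot f b b≢0 homogenised≡0)
      where
      g : Series
      g = reversed ℓ a
      -- the candidate root f/b, f ≡ g·G (mod t^ℓ), b = g
      f b : Poly
      f = truncate ℓ (g ⊛ u)
      b = truncate (suc ℓ) g

      b≈g : toSeries b ≈ g
      b≈g = mk≈ λ k → case-≤ k (k ℕ.≤? ℓ)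
        where
        case-≤ : ∀ k → Dec (k ≤ ℓ) → toSeries b k ≡ g k
        case-≤ k (yes k≤ℓ) = truncate-below (suc ℓ) g k (s≤s k≤ℓ)
        case-≤ k (no k≰ℓ) = trans (truncate-above (suc ℓ) g k (ℕP.≰⇒> k≰ℓ)) (sym (reversed-above ℓ a k (ℕP.≰⇒> k≰ℓ)))

      -- b(0) = a_ℓ = 1
      b≢0 : NonZeroPoly b
      b≢0 = here (λ b₀≡0 → 0≢1 (trans (sym b₀≡0) (trans (reversed-below ℓ a 0 z≤n) leading)))

      -- below t^N, f agrees with g·G: above t^ℓ the coefficients of g·G are the relations
      f≈gG : toSeries f ≈[ N ] (g ⊛ u)
      f≈gG k k<N with k ℕ.<? ℓ
      ... | yes k<ℓ = truncate-below ℓ (g ⊛ u) k k<ℓ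
      ... | no k≮ℓ = trans (truncate-above ℓ (g ⊛ u) k ℓ≤k) (sym (begin
          (g ⊛ u) k                           ≡⟨ cong (g ⊛ u) (sym k∸ℓ+ℓ≡k) ⟩
          (g ⊛ u) ((k ∸ ℓ) ℕ.+ ℓ)             ≡⟨ reversed-⊛ ℓ a (k ∸ ℓ) ⟩
          discrepancy a (suc ℓ) (k ∸ ℓ)       ≡⟨ annihilates (k ∸ ℓ) (subst (_< N) (sym k∸ℓ+ℓ≡k) k<N) ⟩
          0#                                  ∎))
        where
        ℓ≤k : ℓ ≤ k
        ℓ≤k = ℕP.≮⇒≥ k≮ℓ
        k∸ℓ+ℓ≡k : (k ∸ ℓ) ℕ.+ ℓ ≡ k
        k∸ℓ+ℓ≡k = ℕP.m∸n+n≡m ℓ≤k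

      vanishesBelow : ∀ k → k < N → homogenised h f b k ≡ 0#
      vanishesBelow k k<N = begin
        homogenisedS h (toSeries f) (toSeries b) k   ≡⟨ homogenisedS-congN h f≈gG (λ j _ → at b≈g j) k k<N ⟩
        homogenisedS h (g ⊛ u) g k                   ≡⟨ at (homogenisedS-clear h g u) k ⟩
        ((g ^S d) ⊛ evalAt h u) k                    ≡⟨ ⊛-zero (g ^S d) (evalAt h u) hG≡0 k ⟩
        0#                                           ∎

      degree : Deg≤ (M ℤ.+ ℤ.+ d ℤ.* ℤ.+ ℓ) (homogenised h f b)
      degree = homogenisedS-degree h Mof≡M ℓ (Deg≤-truncate ℓ (g ⊛ u))
                 (Deg≤-mono (ℤP.≤-reflexive (identity (ℤ.+ ℓ))) (Deg≤-truncate (suc ℓ) g))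
        where
        identity : ∀ L → (ℤ.+ 1 ℤ.+ L) ℤ.- ℤ.+ 1 ≡ L
        identity = solve-∀

      M+dℓ<N : M ℤ.+ ℤ.+ d ℤ.* ℤ.+ ℓ ℤ.< ℤ.+ N
      M+dℓ<N = ℤP.suc[i]≤j⇒i<j (≤-byDifference _ 0ℤ (ℤP.i≤j⇒0≤j-i (ℤP.i<j⇒suc[i]≤j (ℤP.≰⇒> N-M≰dℓ))) ℤP.≤-refl
                                                (identity M (ℤ.+ d ℤ.* ℤ.+ ℓ) (ℤ.+ N)))
        where
        identity : ∀ M X N → N ℤ.- (ℤ.+ 1 ℤ.+ (M ℤ.+ X)) ≡ ((N ℤ.- M) ℤ.- (ℤ.+ 1 ℤ.+ X)) ℤ.+ 0ℤ
        identity = solve-∀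

      homogenised≡0 : IsZeroSeries (homogenised h f b)
      homogenised≡0 k with k ℕ.<? N
      ... | yes k<N = vanishesBelow k k<N
      ... | no k≮N = degree k (ℤP.<-≤-trans M+dℓ<N (ℤ.+≤+ (ℕP.≮⇒≥ k≮N)))

open import Data.Integer using (+_; _+_; _-_; _*_)

theorem1 : {q : ℕ} (F : FiniteField q) → IsPrimePower q →
    let open FiniteField F using (Carrier) in
    let open FieldNotions F in
    (u : ℕ → Carrier) → IsAutomatic q u → ¬ UltimatelyPeriodic u →
    (d : ℕ) (h : SPoly d) → NonZeroSPoly h →
    IsZeroSeries (evalAt h u) → NoRationalRoot h →
    (M : ℤ) → Mof h ≡ just M →
    (N : ℕ) → 1 ≤ N → (L : ℕ) → IsLinearComplexity u N L →
    (+ N - M ≤ℤ + d * + L) × (+ d * + L ≤ℤ (+ d - + 1) * + N + M + + 1)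
theorem1 F _ u _ _ d h _ hG≡0 noRoot M Mof≡M N _ L (hasRecurrence , minimal) = lower , upper
  where
  open Proof F
  open Recurrences u
  open LowerBound u h hG≡0 noRoot Mof≡M
  open UpperBoundArithmetic d M

  -- d = 0 would make the lower bound N − M ≤ 0 hold for all N
  d≥1 : 1 ≤ d
  d≥1 = ℕP.n≢0⇒n>0 λ d≡0 →
    overshoot (subst (λ e → + suc ℤ.∣ M ∣ - M ≤ℤ + e * + suc ℤ.∣ M ∣) d≡0 (lower-bound (trivialAnnihilator _)))

  open Massey UpperBound (upperBound-zero (lower-bound (trivialAnnihilator 0)))
              (upperBound-suc d≥1) (λ shorter → upperBound-jump (lower-bound shorter))

  lower : + N - M ≤ℤ + d * + L
  lower = lower-bound (fromHasRecurrence hasRecurrence)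

  -- Massey's recurrence of length ℓ satisfies the bound, and L ≤ ℓ by minimality
  upper : + d * + L ≤ℤ (+ d - + 1) * + N + M + + 1
  upper with massey N
  ... | ℓ , (_ , valid) , bound = ℤP.≤-trans (ℤP.*-monoˡ-≤-nonNeg (+ d) (ℤ.+≤+ L≤ℓ)) bound
    where
    L≤ℓ : L ≤ ℓ
    L≤ℓ = ℕP.≮⇒≥ (λ ℓ<L → minimal ℓ ℓ<L (toHasRecurrence valid))
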